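{- For every $n\geqslant 2$ there exists an EF-protocol for the matrix $N^0_n$ in which at most $2\lceil\log n\rceil$ bits are exchanged.
   Context: For integers $n\geqslant1$ and $k$, $N^k_n$ is the $2^n\times 2^n$ matrix with rows and columns indexed by $\{0,1\}^n$ and entries $N^k_n(a,b)=(a^\intercal b-k)(a^\intercal b-k-1)$. For a nonnegative matrix $M$, an EF-protocol is a two-party communication protocol in which Alice receives a row index $i$ and Bob a column index $j$; they may perform arbitrary computations, use private randomness and exchange bits, and eventually one of them outputs a nonnegative number $X_{ij}$; it is an EF-protocol for $M$ if $\mathbb{E}[X_{ij}]=M_{ij}$ for all $(i,j)$. Its complexity is the maximum number of bits exchanged over all inputs. -}

module Defs where

open import Data.Bool using (Bool; true; false)
open import Data.Nat as ℕ using (ℕ; zero; suc; _⊔_)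
open import Data.Integer as ℤ using (ℤ; +_)
open import Data.Rational as ℚ using (ℚ; 0ℚ)
open import Data.Fin using (Fin)
open import Data.Vec using (Vec; []; _∷_)
open import Data.List using (List; map; sum)
open import Data.List as L using ()
open import Data.Product using (_×_; _,_; Σ)
open import Relation.Binary.PropositionalEquality using (_≡_)

_·_ : ∀ {n} → Vec Bool n → Vec Bool n → ℕ
[] · [] = 0
(true ∷ a) · (true ∷ b) = suc (a · b)
(_ ∷ a) · (_ ∷ b) = a · b

N : (n : ℕ) → ℤ → Vec Bool n → Vec Bool n → ℚ
N n k a b = let x = + (a · b) ℤ.- k in ℚ._/_ (x ℤ.* (x ℤ.- ℤ.1ℤ)) 1

-- Each internal node is one transmitted bit, computed by the sending party
-- from its own view (the transcript so far is the position in the tree);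
-- a leaf is an output computed by one of the parties from its own view.
data Protocol (X Y : Set) : Set where
  outA  : (X → ℚ) → Protocol X Y
  outB  : (Y → ℚ) → Protocol X Y
  sendA : (X → Bool) → (Bool → Protocol X Y) → Protocol X Y
  sendB : (Y → Bool) → (Bool → Protocol X Y) → Protocol X Y

cost : ∀ {X Y} → Protocol X Y → ℕ
cost (outA _) = 0
cost (outB _) = 0
cost (sendA _ k) = suc (cost (k false) ⊔ cost (k true))
cost (sendB _ k) = suc (cost (k false) ⊔ cost (k true))

data NonNegOut {X Y : Set} : Protocol X Y → Set where
  outA  : ∀ {f} → (∀ x → ℚ._≤_ 0ℚ (f x)) → NonNegOut (outA f)
  outB  : ∀ {f} → (∀ y → ℚ._≤_ 0ℚ (f y)) → NonNegOut (outB f)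
  sendA : ∀ {m k} → (∀ c → NonNegOut (k c)) → NonNegOut (sendA m k)
  sendB : ∀ {m k} → (∀ c → NonNegOut (k c)) → NonNegOut (sendB m k)

run : ∀ {X Y} → Protocol X Y → X → Y → ℚ
run (outA f) x y = f x
run (outB f) x y = f y
run (sendA m k) x y = run (k (m x)) x y
run (sendB m k) x y = run (k (m y)) x y

ΣFin : (m : ℕ) → (Fin m → ℚ) → ℚ
ΣFin zero f = 0ℚ
ΣFin (suc m) f = f Fin.zero ℚ.+ ΣFin m (λ i → f (Fin.suc i))
  where import Data.Fin as Fin

-- A randomized protocol with private randomness: Alice draws r uniformly
-- from Fin (suc rA), Bob draws s uniformly from Fin (suc rB), independently;
-- the (deterministic) protocol tree then runs on Alice's view (i , r) and
-- Bob's view (j , s).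
record RandProtocol (I J : Set) : Set where
  field
    rA rB : ℕ
    tree  : Protocol (I × Fin (suc rA)) (J × Fin (suc rB))
open RandProtocol public

expect : ∀ {I J} → RandProtocol I J → I → J → ℚ
expect P i j =
  ΣFin (suc (rA P)) (λ r → ΣFin (suc (rB P)) (λ s → run (tree P) (i , r) (j , s)))
  ℚ.* ℚ._/_ (+ 1) (suc (rA P) ℕ.* suc (rB P))

IsEFProtocol : ∀ {I J} → (I → J → ℚ) → RandProtocol I J → Set
IsEFProtocol M P = NonNegOut (tree P) × (∀ i j → expect P i j ≡ M i j)

-- Alice draws a uniform index i and announces it; Bob draws a uniform index s and
-- answers s if b_i = b_s = 1 and s ≠ i, and echoes i otherwise; Alice, having
-- received j, outputs n² if a_i = a_j = 1 and j ≠ i, and 0 otherwise.  The output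
-- is nonzero exactly when (i, s) is an ordered pair of distinct common ones of a
-- and b, so its expectation is the number k(k - 1) of such pairs, k = aᵀb.  Both
-- messages are indices below n, i.e. ⌈log₂ n⌉ bits each.
module Submission where

open import Algebra.Bundles using (CommutativeMonoid)
open import Data.Bool using (Bool; true; false; if_then_else_; _∧_; not)
open import Data.Bool.Properties using (∧-identityʳ; ∧-zeroʳ; ∧-idem; T-≡)
open import Data.Fin as Fin using (Fin; toℕ)
open import Data.Fin.Properties using (toℕ<n)
open import Data.Integer as ℤ using (ℤ; +_)
import Data.Integer.Properties as ℤₚ
import Data.Integer.Tactic.RingSolver as ℤ-Solver
open import Data.Nat as ℕ using (ℕ; zero; suc; _≤_; _<_; _^_; _≡ᵇ_; ⌈_/2⌉; z≤n; s≤s)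
import Data.Nat.Properties as ℕₚ
open import Data.Nat.Induction using (<-wellFounded)
open import Data.Nat.Logarithm using (⌈log₂_⌉)
open import Data.Nat.Logarithm.Core using (⌈log2⌉)
import Data.Nat.Tactic.RingSolver as ℕ-Solver
open import Data.Product using (Σ; _×_; _,_; proj₂)
open import Data.Rational as ℚ using (ℚ; 0ℚ; 1ℚ; _+_; _*_; _-_; _/_; toℚᵘ)
import Data.Rational.Properties as ℚₚ
import Data.Rational.Unnormalised as ℚᵘ
import Data.Rational.Unnormalised.Properties as ℚᵘₚ
open import Data.Rational.Solver using (module +-*-Solver)
open import Data.Vec using (Vec; []; _∷_)
open import Function using (_∘_)
open import Function.Bundles using (Equivalence)
open import Induction.WellFounded using (Acc; acc)
open import Relation.Binary.PropositionalEquality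

open import Defs

private
  variable
    X Y : Set

fromℤ : ℤ → ℚ
fromℤ z = z / 1

toℚᵘ-fromℤ : ∀ z → toℚᵘ (fromℤ z) ℚᵘ.≃ ℚᵘ.mkℚᵘ z 0
toℚᵘ-fromℤ z = ℚₚ.toℚᵘ-fromℚᵘ (ℚᵘ.mkℚᵘ z 0)

fromℤ-+ : ∀ z w → fromℤ (z ℤ.+ w) ≡ fromℤ z + fromℤ w
fromℤ-+ z w = ℚₚ.toℚᵘ-injective (begin
  toℚᵘ (fromℤ (z ℤ.+ w))               ≈⟨ toℚᵘ-fromℤ (z ℤ.+ w) ⟩
  ℚᵘ.mkℚᵘ (z ℤ.+ w) 0                  ≈⟨ ℚᵘ.*≡* (cross-multiplied z w) ⟩
  ℚᵘ.mkℚᵘ z 0 ℚᵘ.+ ℚᵘ.mkℚᵘ w 0         ≈⟨ ℚᵘₚ.+-cong (ℚᵘₚ.≃-sym (toℚᵘ-fromℤ z)) (ℚᵘₚ.≃-sym (toℚᵘ-fromℤ w)) ⟩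
  toℚᵘ (fromℤ z) ℚᵘ.+ toℚᵘ (fromℤ w)   ≈⟨ ℚᵘₚ.≃-sym (ℚₚ.toℚᵘ-homo-+ (fromℤ z) (fromℤ w)) ⟩
  toℚᵘ (fromℤ z + fromℤ w)             ∎)
  where
  open ℚᵘₚ.≃-Reasoning
  cross-multiplied : ∀ z w → (z ℤ.+ w) ℤ.* ℤ.1ℤ ≡ (z ℤ.* ℤ.1ℤ ℤ.+ w ℤ.* ℤ.1ℤ) ℤ.* ℤ.1ℤ
  cross-multiplied = ℤ-Solver.solve-∀

fromℤ-* : ∀ z w → fromℤ (z ℤ.* w) ≡ fromℤ z * fromℤ w
fromℤ-* z w = ℚₚ.toℚᵘ-injective (begin
  toℚᵘ (fromℤ (z ℤ.* w))               ≈⟨ toℚᵘ-fromℤ (z ℤ.* w) ⟩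
  ℚᵘ.mkℚᵘ z 0 ℚᵘ.* ℚᵘ.mkℚᵘ w 0         ≈⟨ ℚᵘₚ.*-cong (ℚᵘₚ.≃-sym (toℚᵘ-fromℤ z)) (ℚᵘₚ.≃-sym (toℚᵘ-fromℤ w)) ⟩
  toℚᵘ (fromℤ z) ℚᵘ.* toℚᵘ (fromℤ w)   ≈⟨ ℚᵘₚ.≃-sym (ℚₚ.toℚᵘ-homo-* (fromℤ z) (fromℤ w)) ⟩
  toℚᵘ (fromℤ z * fromℤ w)             ∎)
  where open ℚᵘₚ.≃-Reasoning

0≤fromℤ+ : ∀ k → 0ℚ ℚ.≤ fromℤ (+ k)
0≤fromℤ+ k = ℚₚ.nonNegative⁻¹ (fromℤ (+ k)) {{ℚₚ.normalize-nonNeg k 1}}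

fromℤ-*-1/ : ∀ k .{{_ : ℕ.NonZero k}} → fromℤ (+ k) * (+ 1 / k) ≡ 1ℚ
fromℤ-*-1/ (suc k) = ℚₚ.toℚᵘ-injective (begin
  toℚᵘ (fromℤ (+ suc k) * (+ 1 / suc k))                ≈⟨ ℚₚ.toℚᵘ-homo-* (fromℤ (+ suc k)) (+ 1 / suc k) ⟩
  toℚᵘ (fromℤ (+ suc k)) ℚᵘ.* toℚᵘ (+ 1 / suc k)        ≈⟨ ℚᵘₚ.*-cong (toℚᵘ-fromℤ (+ suc k)) (ℚₚ.toℚᵘ-fromℚᵘ (ℚᵘ.mkℚᵘ (+ 1) k)) ⟩
  ℚᵘ.mkℚᵘ (+ suc k) 0 ℚᵘ.* ℚᵘ.mkℚᵘ (+ 1) k            ≈⟨ ℚᵘ.*≡* (cross-multiplied k) ⟩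
  ℚᵘ.1ℚᵘ                                               ∎)
  where
  open ℚᵘₚ.≃-Reasoning
  cross-multiplied : ∀ k → (+ suc k ℤ.* + 1) ℤ.* + 1 ≡ + 1 ℤ.* + suc (k ℕ.+ 0)
  cross-multiplied k = trans (ℤₚ.*-identityʳ _) (trans (ℤₚ.*-identityʳ _)
    (sym (trans (ℤₚ.*-identityˡ (+ suc (k ℕ.+ 0))) (cong (+_ ∘ suc) (ℕₚ.+-identityʳ k)))))

N₀≡x[x-1] : ∀ {n} (a b : Vec Bool n) → N n (+ 0) a b ≡ fromℤ (+ (a · b)) * (fromℤ (+ (a · b)) - 1ℚ)
N₀≡x[x-1] a b = begin
  fromℤ ((x ℤ.- + 0) ℤ.* ((x ℤ.- + 0) ℤ.- ℤ.1ℤ))  ≡⟨ cong (λ y → fromℤ (y ℤ.* (y ℤ.- ℤ.1ℤ))) (ℤₚ.+-identityʳ x) ⟩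
  fromℤ (x ℤ.* (x ℤ.- ℤ.1ℤ))                      ≡⟨ fromℤ-* x (x ℤ.- ℤ.1ℤ) ⟩
  fromℤ x * fromℤ (x ℤ.- ℤ.1ℤ)                    ≡⟨ cong (fromℤ x *_) (fromℤ-+ x (ℤ.- ℤ.1ℤ)) ⟩
  -- fromℤ (ℤ.- 1ℤ) and ℚ.- 1ℚ have the same normal form, so this last step is definitional
  fromℤ x * (fromℤ x - 1ℚ)                        ∎
  where
  open ≡-Reasoning
  x = + (a · b)

ΣFin-cong : ∀ m {f g : Fin m → ℚ} → (∀ i → f i ≡ g i) → ΣFin m f ≡ ΣFin m g
ΣFin-cong zero    f≡g = refl
ΣFin-cong (suc m) f≡g = cong₂ _+_ (f≡g Fin.zero) (ΣFin-cong m (f≡g ∘ Fin.suc))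

ΣFin-distrib-+ : ∀ m (f g : Fin m → ℚ) → ΣFin m (λ i → f i + g i) ≡ ΣFin m f + ΣFin m g
ΣFin-distrib-+ zero    f g = refl
ΣFin-distrib-+ (suc m) f g = trans
  (cong (λ s → (f Fin.zero + g Fin.zero) + s) (ΣFin-distrib-+ m (f ∘ Fin.suc) (g ∘ Fin.suc)))
  (interchange (f Fin.zero) (g Fin.zero) (ΣFin m (f ∘ Fin.suc)) (ΣFin m (g ∘ Fin.suc)))
  where open import Algebra.Properties.CommutativeSemigroup
          (CommutativeMonoid.commutativeSemigroup ℚₚ.+-0-commutativeMonoid) using (interchange)

*-distribˡ-ΣFin : ∀ m q (f : Fin m → ℚ) → q * ΣFin m f ≡ ΣFin m (λ i → q * f i)
*-distribˡ-ΣFin zero    q f = ℚₚ.*-zeroʳ q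
*-distribˡ-ΣFin (suc m) q f = trans
  (ℚₚ.*-distribˡ-+ q (f Fin.zero) (ΣFin m (f ∘ Fin.suc)))
  (cong (λ s → q * f Fin.zero + s) (*-distribˡ-ΣFin m q (f ∘ Fin.suc)))

𝟙 : Bool → ℚ
𝟙 true  = 1ℚ
𝟙 false = 0ℚ

𝟙-∧ : ∀ a b → 𝟙 (a ∧ b) ≡ 𝟙 a * 𝟙 b
𝟙-∧ true  b = sym (ℚₚ.*-identityˡ (𝟙 b))
𝟙-∧ false b = sym (ℚₚ.*-zeroˡ (𝟙 b))

count : ℕ → (ℕ → Bool) → ℚ
count m c = ΣFin m (λ i → 𝟙 (c (toℕ i)))

offDiag : (ℕ → Bool) → ℕ → ℕ → Bool
offDiag c i j = c i ∧ c j ∧ not (i ≡ᵇ j)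

offDiag-diag : ∀ c i → offDiag c i i ≡ false
offDiag-diag c i rewrite Equivalence.to T-≡ (ℕₚ.≡⇒≡ᵇ i i refl) =
  trans (cong (c i ∧_) (∧-zeroʳ (c i))) (∧-zeroʳ (c i))

offDiag-∧ : ∀ p q i j → offDiag (λ t → p t ∧ q t) i j ≡ offDiag p i j ∧ offDiag q i j
offDiag-∧ p q i j = ∧-distrib-shared (p i) (q i) (p j) (q j) (not (i ≡ᵇ j))
  where
  ∧-distrib-shared : ∀ a b c d e → (a ∧ b) ∧ (c ∧ d) ∧ e ≡ (a ∧ c ∧ e) ∧ (b ∧ d ∧ e)
  ∧-distrib-shared false b     c     d     e = refl
  ∧-distrib-shared true  false c     d     e = sym (∧-zeroʳ (c ∧ e))
  ∧-distrib-shared true  true  false d     e = refl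
  ∧-distrib-shared true  true  true  false e = sym (∧-zeroʳ e)
  ∧-distrib-shared true  true  true  true  e = sym (∧-idem e)

pairs : ℕ → (ℕ → Bool) → ℚ
pairs m c = ΣFin m (λ i → ΣFin m (λ j → 𝟙 (offDiag c (toℕ i) (toℕ j))))

pairs-suc : ∀ m c → let x = 𝟙 (c 0); y = count m (c ∘ suc) in
            pairs (suc m) c ≡ x * y + (x * y + pairs m (c ∘ suc))
pairs-suc m c = begin
  (𝟙 (offDiag c 0 0) + ΣFin m (λ j → 𝟙 (offDiag c 0 (suc (toℕ j)))))
    + ΣFin m (λ i → 𝟙 (offDiag c (suc (toℕ i)) 0) + row (toℕ i))
      ≡⟨ cong₂ _+_ (cong₂ _+_ (cong 𝟙 (offDiag-diag c 0)) (ΣFin-cong m (first-row ∘ toℕ)))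
                   (ΣFin-cong m (λ i → cong (λ s → s + row (toℕ i)) (first-column (toℕ i)))) ⟩
  (0ℚ + ΣFin m (λ j → x * 𝟙 (c (suc (toℕ j)))))
    + ΣFin m (λ i → x * 𝟙 (c (suc (toℕ i))) + row (toℕ i))
      ≡⟨ cong₂ _+_ (trans (ℚₚ.+-identityˡ _) (sym (*-distribˡ-ΣFin m x _)))
                   (trans (ΣFin-distrib-+ m _ _) (cong (_+ pairs m (c ∘ suc)) (sym (*-distribˡ-ΣFin m x _)))) ⟩
  x * y + (x * y + pairs m (c ∘ suc))
      ∎
  where
  open ≡-Reasoning
  x = 𝟙 (c 0)
  y = count m (c ∘ suc)
  row : ℕ → ℚ
  row i = ΣFin m (λ j → 𝟙 (offDiag (c ∘ suc) i (toℕ j)))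
  first-row : ∀ j → 𝟙 (offDiag c 0 (suc j)) ≡ x * 𝟙 (c (suc j))
  first-row j = trans (cong (λ b → 𝟙 (c 0 ∧ b)) (∧-identityʳ (c (suc j)))) (𝟙-∧ (c 0) (c (suc j)))
  first-column : ∀ i → 𝟙 (offDiag c (suc i) 0) ≡ x * 𝟙 (c (suc i))
  first-column i = trans (cong (λ b → 𝟙 (c (suc i) ∧ b)) (∧-identityʳ (c 0)))
                         (trans (𝟙-∧ (c (suc i)) (c 0)) (ℚₚ.*-comm (𝟙 (c (suc i))) x))

falling-𝟙+ : ∀ b y → 𝟙 b * y + (𝟙 b * y + y * (y - 1ℚ)) ≡ (𝟙 b + y) * ((𝟙 b + y) - 1ℚ)
falling-𝟙+ true  = solve 1 (λ y → con 1ℚ :* y :+ (con 1ℚ :* y :+ y :* (y :- con 1ℚ))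
                           := (con 1ℚ :+ y) :* ((con 1ℚ :+ y) :- con 1ℚ)) refl
  where open +-*-Solver
falling-𝟙+ false = solve 1 (λ y → con 0ℚ :* y :+ (con 0ℚ :* y :+ y :* (y :- con 1ℚ))
                           := (con 0ℚ :+ y) :* ((con 0ℚ :+ y) :- con 1ℚ)) refl
  where open +-*-Solver

pairs≡count*[count-1] : ∀ m c → pairs m c ≡ count m c * (count m c - 1ℚ)
pairs≡count*[count-1] zero    c = refl
pairs≡count*[count-1] (suc m) c = begin
  pairs (suc m) c                         ≡⟨ pairs-suc m c ⟩
  x * y + (x * y + pairs m (c ∘ suc))     ≡⟨ cong (λ p → x * y + (x * y + p)) (pairs≡count*[count-1] m (c ∘ suc)) ⟩
  x * y + (x * y + y * (y - 1ℚ))          ≡⟨ falling-𝟙+ (c 0) y ⟩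
  (x + y) * ((x + y) - 1ℚ)                ∎
  where
  open ≡-Reasoning
  x = 𝟙 (c 0)
  y = count m (c ∘ suc)

lookupℕ : ∀ {n} → Vec Bool n → ℕ → Bool
lookupℕ []      _       = false
lookupℕ (x ∷ v) zero    = x
lookupℕ (x ∷ v) (suc i) = lookupℕ v i

common : ∀ {n} → Vec Bool n → Vec Bool n → ℕ → Bool
common a b t = lookupℕ a t ∧ lookupℕ b t

count-common≡· : ∀ {n} (a b : Vec Bool n) → count n (common a b) ≡ fromℤ (+ (a · b))
count-common≡· []          []          = refl
count-common≡· (true ∷ a)  (true ∷ b)  = trans (cong (_+_ 1ℚ) (count-common≡· a b)) (sym (fromℤ-+ (+ 1) (+ (a · b))))
count-common≡· (true ∷ a)  (false ∷ b) = trans (ℚₚ.+-identityˡ _) (count-common≡· a b)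
count-common≡· (false ∷ a) (true ∷ b)  = trans (ℚₚ.+-identityˡ _) (count-common≡· a b)
count-common≡· (false ∷ a) (false ∷ b) = trans (ℚₚ.+-identityˡ _) (count-common≡· a b)

swap : Protocol X Y → Protocol Y X
swap (outA f)    = outB f
swap (outB f)    = outA f
swap (sendA m k) = sendB m (swap ∘ k)
swap (sendB m k) = sendA m (swap ∘ k)

run-swap : ∀ (p : Protocol X Y) x y → run (swap p) y x ≡ run p x y
run-swap (outA f)    x y = refl
run-swap (outB f)    x y = refl
run-swap (sendA m k) x y = run-swap (k (m x)) x y
run-swap (sendB m k) x y = run-swap (k (m y)) x y

cost-swap : ∀ (p : Protocol X Y) → cost (swap p) ≡ cost p
cost-swap (outA f)    = refl
cost-swap (outB f)    = refl
cost-swap (sendA m k) = cong suc (cong₂ ℕ._⊔_ (cost-swap (k false)) (cost-swap (k true)))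
cost-swap (sendB m k) = cong suc (cong₂ ℕ._⊔_ (cost-swap (k false)) (cost-swap (k true)))

NonNegOut-swap : {p : Protocol X Y} → NonNegOut p → NonNegOut (swap p)
NonNegOut-swap (outA f≥0)  = outB f≥0
NonNegOut-swap (outB f≥0)  = outA f≥0
NonNegOut-swap (sendA k≥0) = sendB (NonNegOut-swap ∘ k≥0)
NonNegOut-swap (sendB k≥0) = sendA (NonNegOut-swap ∘ k≥0)

bit : Bool → ℕ
bit false = 0
bit true  = 1

lowBit : ℕ → Bool
lowBit zero          = false
lowBit (suc zero)    = true
lowBit (suc (suc n)) = lowBit n

bit-lowBit+2*⌊n/2⌋ : ∀ n → bit (lowBit n) ℕ.+ 2 ℕ.* ℕ.⌊ n /2⌋ ≡ n
bit-lowBit+2*⌊n/2⌋ zero          = refl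
bit-lowBit+2*⌊n/2⌋ (suc zero)    = refl
bit-lowBit+2*⌊n/2⌋ (suc (suc n)) =
  trans (shift (bit (lowBit n)) ℕ.⌊ n /2⌋) (cong (suc ∘ suc) (bit-lowBit+2*⌊n/2⌋ n))
  where
  shift : ∀ b h → b ℕ.+ 2 ℕ.* suc h ≡ suc (suc (b ℕ.+ 2 ℕ.* h))
  shift = ℕ-Solver.solve-∀

⌊n/2⌋<2^d : ∀ d n → n < 2 ^ suc d → ℕ.⌊ n /2⌋ < 2 ^ d
⌊n/2⌋<2^d d n n<2^[1+d] = ℕₚ.*-cancelˡ-< 2 ℕ.⌊ n /2⌋ (2 ^ d) (ℕₚ.≤-<-trans 2*⌊n/2⌋≤n n<2^[1+d])
  where
  2*⌊n/2⌋≤n : 2 ℕ.* ℕ.⌊ n /2⌋ ≤ n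
  2*⌊n/2⌋≤n = subst (2 ℕ.* ℕ.⌊ n /2⌋ ≤_) (bit-lowBit+2*⌊n/2⌋ n) (ℕₚ.m≤n+m _ (bit (lowBit n)))

sendNatA : ℕ → (X → ℕ) → (ℕ → Protocol X Y) → Protocol X Y
sendNatA zero    f k = k 0
sendNatA (suc d) f k =
  sendA (lowBit ∘ f) (λ c → sendNatA d (λ x → ℕ.⌊ f x /2⌋) (λ m → k (bit c ℕ.+ 2 ℕ.* m)))

sendNatB : ℕ → (Y → ℕ) → (ℕ → Protocol X Y) → Protocol X Y
sendNatB d f k = swap (sendNatA d f (swap ∘ k))

run-sendNatA : ∀ d (f : X → ℕ) (k : ℕ → Protocol X Y) x y → f x < 2 ^ d →
               run (sendNatA d f k) x y ≡ run (k (f x)) x y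
run-sendNatA zero    f k x y fx<1 with f x | fx<1
... | zero  | _         = refl
... | suc _ | s≤s ()
run-sendNatA (suc d) f k x y fx<2^d = trans
  (run-sendNatA d (λ x → ℕ.⌊ f x /2⌋) _ x y (⌊n/2⌋<2^d d (f x) fx<2^d))
  (cong (λ v → run (k v) x y) (bit-lowBit+2*⌊n/2⌋ (f x)))

run-sendNatB : ∀ d (f : Y → ℕ) (k : ℕ → Protocol X Y) x y → f y < 2 ^ d →
               run (sendNatB d f k) x y ≡ run (k (f y)) x y
run-sendNatB d f k x y fy<2^d = begin
  run (swap (sendNatA d f (swap ∘ k))) x y  ≡⟨ run-swap (sendNatA d f (swap ∘ k)) y x ⟩
  run (sendNatA d f (swap ∘ k)) y x         ≡⟨ run-sendNatA d f (swap ∘ k) y x fy<2^d ⟩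
  run (swap (k (f y))) y x                  ≡⟨ run-swap (k (f y)) x y ⟩
  run (k (f y)) x y                         ∎
  where open ≡-Reasoning

cost-sendNatA : ∀ d (f : X → ℕ) (k : ℕ → Protocol X Y) {c} →
                (∀ m → cost (k m) ≤ c) → cost (sendNatA d f k) ≤ d ℕ.+ c
cost-sendNatA zero    f k k≤c = k≤c 0
cost-sendNatA (suc d) f k k≤c = s≤s (ℕₚ.⊔-lub (cost-sendNatA d _ _ (λ _ → k≤c _)) (cost-sendNatA d _ _ (λ _ → k≤c _)))

cost-sendNatB : ∀ d (f : Y → ℕ) (k : ℕ → Protocol X Y) {c} →
                (∀ m → cost (k m) ≤ c) → cost (sendNatB d f k) ≤ d ℕ.+ c
cost-sendNatB d f k k≤c = subst (_≤ _) (sym (cost-swap (sendNatA d f (swap ∘ k))))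
  (cost-sendNatA d f (swap ∘ k) (λ m → subst (_≤ _) (sym (cost-swap (k m))) (k≤c m)))

NonNegOut-sendNatA : ∀ d (f : X → ℕ) (k : ℕ → Protocol X Y) →
                     (∀ m → NonNegOut (k m)) → NonNegOut (sendNatA d f k)
NonNegOut-sendNatA zero    f k k≥0 = k≥0 0
NonNegOut-sendNatA (suc d) f k k≥0 = sendA (λ c → NonNegOut-sendNatA d _ _ (λ _ → k≥0 _))

NonNegOut-sendNatB : ∀ d (f : Y → ℕ) (k : ℕ → Protocol X Y) →
                     (∀ m → NonNegOut (k m)) → NonNegOut (sendNatB d f k)
NonNegOut-sendNatB d f k k≥0 = NonNegOut-swap (NonNegOut-sendNatA d f (swap ∘ k) (NonNegOut-swap ∘ k≥0))

n≤2^⌈log₂n⌉ : ∀ n → n ≤ 2 ^ ⌈log₂ n ⌉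
n≤2^⌈log₂n⌉ n = n≤2^⌈log2⌉n n (<-wellFounded n)
  where
  n≤2^⌈log2⌉n : ∀ n (rec : Acc _<_ n) → n ≤ 2 ^ ⌈log2⌉ n rec
  n≤2^⌈log2⌉n zero          _         = z≤n
  n≤2^⌈log2⌉n (suc zero)    _         = s≤s z≤n
  n≤2^⌈log2⌉n (suc (suc n)) (acc rec) = begin
    2 ℕ.+ n                   ≤⟨ ℕₚ.+-monoʳ-≤ 2 n≤2⌈n/2⌉ ⟩
    2 ℕ.+ 2 ℕ.* h             ≡⟨ 2+2*h≡2*[1+h] h ⟩
    2 ℕ.* suc h               ≤⟨ ℕₚ.*-monoʳ-≤ 2 (n≤2^⌈log2⌉n (suc h) _) ⟩
    2 ℕ.* 2 ^ ⌈log2⌉ (suc h) _ ∎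
    where
    open ℕₚ.≤-Reasoning
    h = ⌈ n /2⌉
    n≤2⌈n/2⌉ : n ≤ 2 ℕ.* h
    n≤2⌈n/2⌉ = subst₂ _≤_ (ℕₚ.⌊n/2⌋+⌈n/2⌉≡n n) (cong (h ℕ.+_) (sym (ℕₚ.+-identityʳ h)))
                          (ℕₚ.+-monoˡ-≤ h (ℕₚ.⌊n/2⌋≤⌈n/2⌉ n))
    2+2*h≡2*[1+h] : ∀ h → 2 ℕ.+ 2 ℕ.* h ≡ 2 ℕ.* suc h
    2+2*h≡2*[1+h] = ℕ-Solver.solve-∀

reply : ∀ {n} → Vec Bool n → ℕ → ℕ → ℕ
reply b i s = if offDiag (lookupℕ b) i s then s else i

offDiag-reply : ∀ p q i s → offDiag p i (if offDiag q i s then s else i) ≡ offDiag p i s ∧ offDiag q i s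
offDiag-reply p q i s with offDiag q i s
... | true  = sym (∧-identityʳ (offDiag p i s))
... | false = trans (offDiag-diag p i) (sym (∧-zeroʳ (offDiag p i s)))

reply-< : ∀ {n} (b : Vec Bool n) {i s B} → i < B → s < B → reply b i s < B
reply-< b {i} {s} i<B s<B with offDiag (lookupℕ b) i s
... | true  = s<B
... | false = i<B

protocol : ∀ n → ℚ → ℕ → Protocol (Vec Bool n × Fin n) (Vec Bool n × Fin n)
protocol n K d =
  sendNatA d (toℕ ∘ proj₂) λ i →
  sendNatB d (λ (b , s) → reply b i (toℕ s)) λ j →
  outA (λ (a , _) → K * 𝟙 (offDiag (lookupℕ a) i j))

run-protocol : ∀ {n} K d (a b : Vec Bool n) (r s : Fin n) → n ≤ 2 ^ d →
               run (protocol n K d) (a , r) (b , s) ≡ K * 𝟙 (offDiag (common a b) (toℕ r) (toℕ s))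
run-protocol {n} K d a b r s n≤2^d = begin
  run (protocol n K d) (a , r) (b , s)
    ≡⟨ run-sendNatA d (toℕ ∘ proj₂) _ (a , r) (b , s) (<2^d r) ⟩
  run (sendNatB d (λ (b , s) → reply b i (toℕ s)) _) (a , r) (b , s)
    ≡⟨ run-sendNatB d _ _ (a , r) (b , s) (reply-< b (<2^d r) (<2^d s)) ⟩
  K * 𝟙 (offDiag (lookupℕ a) i (reply b i j))
    ≡⟨ cong (λ t → K * 𝟙 t) (offDiag-reply (lookupℕ a) (lookupℕ b) i j) ⟩
  K * 𝟙 (offDiag (lookupℕ a) i j ∧ offDiag (lookupℕ b) i j)
    ≡⟨ cong (λ t → K * 𝟙 t) (sym (offDiag-∧ (lookupℕ a) (lookupℕ b) i j)) ⟩
  K * 𝟙 (offDiag (common a b) i j)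
    ∎
  where
  open ≡-Reasoning
  i = toℕ r
  j = toℕ s
  <2^d : (t : Fin n) → toℕ t < 2 ^ d
  <2^d t = ℕₚ.<-≤-trans (toℕ<n t) n≤2^d

cost-protocol : ∀ n K d → cost (protocol n K d) ≤ 2 ℕ.* d
cost-protocol n K d = cost-sendNatA d _ _ (λ _ → cost-sendNatB d _ _ (λ _ → z≤n))

NonNegOut-protocol : ∀ n {K} d → 0ℚ ℚ.≤ K → NonNegOut (protocol n K d)
NonNegOut-protocol n {K} d K≥0 =
  NonNegOut-sendNatA d _ _ λ i → NonNegOut-sendNatB d _ _ λ j →
  outA (λ (a , _) → K*𝟙≥0 (offDiag (lookupℕ a) i j))
  where
  K*𝟙≥0 : ∀ b → 0ℚ ℚ.≤ K * 𝟙 b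
  K*𝟙≥0 true  = subst (0ℚ ℚ.≤_) (sym (ℚₚ.*-identityʳ K)) K≥0
  K*𝟙≥0 false = subst (0ℚ ℚ.≤_) (sym (ℚₚ.*-zeroʳ K)) ℚₚ.≤-refl

pairs-common≡N₀ : ∀ {n} (a b : Vec Bool n) → pairs n (common a b) ≡ N n (+ 0) a b
pairs-common≡N₀ {n} a b = begin
  pairs n (common a b)                                  ≡⟨ pairs≡count*[count-1] n (common a b) ⟩
  count n (common a b) * (count n (common a b) - 1ℚ)    ≡⟨ cong (λ x → x * (x - 1ℚ)) (count-common≡· a b) ⟩
  fromℤ (+ (a · b)) * (fromℤ (+ (a · b)) - 1ℚ)          ≡⟨ N₀≡x[x-1] a b ⟨
  N n (+ 0) a b                                         ∎
  where open ≡-Reasoning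

uniformPairProtocol : ∀ m → RandProtocol (Vec Bool (suc m)) (Vec Bool (suc m))
uniformPairProtocol m = record
  { rA = m ; rB = m ; tree = protocol (suc m) (fromℤ (+ (suc m ℕ.* suc m))) ⌈log₂ suc m ⌉ }

expect-uniformPairProtocol : ∀ m (a b : Vec Bool (suc m)) →
                             expect (uniformPairProtocol m) a b ≡ pairs (suc m) (common a b)
expect-uniformPairProtocol m a b = begin
  ΣFin n (λ r → ΣFin n (λ s → run (protocol n K d) (a , r) (b , s))) * q
    ≡⟨ cong (_* q) (ΣFin-cong n λ r → ΣFin-cong n λ s → run-protocol K d a b r s (n≤2^⌈log₂n⌉ n)) ⟩
  ΣFin n (λ r → ΣFin n (λ s → K * pair r s)) * q
    ≡⟨ cong (_* q) (ΣFin-cong n λ r → *-distribˡ-ΣFin n K (pair r)) ⟨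
  ΣFin n (λ r → K * ΣFin n (pair r)) * q
    ≡⟨ cong (_* q) (*-distribˡ-ΣFin n K (λ r → ΣFin n (pair r))) ⟨
  (K * pairs n (common a b)) * q
    ≡⟨ cong (_* q) (ℚₚ.*-comm K _) ⟩
  (pairs n (common a b) * K) * q
    ≡⟨ ℚₚ.*-assoc (pairs n (common a b)) K q ⟩
  pairs n (common a b) * (K * q)
    ≡⟨ cong (pairs n (common a b) *_) (fromℤ-*-1/ (n ℕ.* n)) ⟩
  pairs n (common a b) * 1ℚ
    ≡⟨ ℚₚ.*-identityʳ (pairs n (common a b)) ⟩
  pairs n (common a b)
    ∎
  where
  open ≡-Reasoning
  n = suc m
  d = ⌈log₂ n ⌉
  K = fromℤ (+ (n ℕ.* n))
  q = + 1 / (n ℕ.* n)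
  pair : Fin n → Fin n → ℚ
  pair r s = 𝟙 (offDiag (common a b) (toℕ r) (toℕ s))

lemma9 : (n : ℕ) → 2 ≤ n →
  Σ (RandProtocol (Vec Bool n) (Vec Bool n)) λ P →
    IsEFProtocol (N n (+ 0)) P × cost (tree P) ≤ 2 ℕ.* ⌈log₂ n ⌉
lemma9 (suc m) _ =
  uniformPairProtocol m ,
  (NonNegOut-protocol n d (0≤fromℤ+ (n ℕ.* n)) ,
   λ a b → trans (expect-uniformPairProtocol m a b) (pairs-common≡N₀ a b)) ,
  cost-protocol n (fromℤ (+ (n ℕ.* n))) d
  where
  n = suc m
  d = ⌈log₂ n ⌉
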